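{- Identifying the edge set of the complete bipartite graph $K_{n,n}$ with $[n]\times[n]$, the polytope $\mathcal{BB}_+(n) := \mathcal{BB}(n)\cap\mathbb{R}^{n\times n}_+$ equals the matching polytope of $K_{n,n}$.
   Context: $\mathcal{BB}(n)$ is the convex hull in $\mathbb{R}^{n\times n}$ of all $n\times n$ signed permutation matrices (matrices with exactly one nonzero entry, equal to $\pm1$, in each row and each column). For a graph $G=(V,E)$, a matching is a set of pairwise disjoint edges, and the matching polytope is $\mathrm{conv}\{\mathbf{1}_M: M\subseteq E\text{ matching}\}\subset\mathbb{R}^E$.
   Formalization: Both polytopes are taken over ℚ^(n×n) instead of ℝ^(n×n): their points have rational entries and their convex combinations use rational weights. -}

module Defs where

open import Data.Nat using (ℕ)
open import Data.Fin using (Fin)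
open import Data.Bool using (Bool; true; false; if_then_else_)
open import Data.Rational using (ℚ; 0ℚ; 1ℚ; -_; _+_; _*_; _≤_)
open import Data.List using (List; []; _∷_)
open import Data.List.Relation.Unary.All using (All)
open import Data.Product using (Σ; ∃; _×_; _,_; proj₁; proj₂)
open import Data.Sum using (_⊎_)
open import Relation.Binary.PropositionalEquality using (_≡_; _≢_)

-- Real n×n matrices are modelled by rational ones.
Matrix : ℕ → Set
Matrix n = Fin n → Fin n → ℚ

IsSignedPerm : ∀ {n} → Matrix n → Set
IsSignedPerm {n} M =
  (∀ i → ∃ λ j → (M i j ≡ 1ℚ ⊎ M i j ≡ - 1ℚ) × (∀ j′ → j′ ≢ j → M i j′ ≡ 0ℚ)) ×
  (∀ j → ∃ λ i → (M i j ≡ 1ℚ ⊎ M i j ≡ - 1ℚ) × (∀ i′ → i′ ≢ i → M i′ j ≡ 0ℚ))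

NonNeg : ∀ {n} → Matrix n → Set
NonNeg M = ∀ i j → 0ℚ ≤ M i j

combo : ∀ {n} → List (ℚ × Matrix n) → Matrix n
combo [] i j = 0ℚ
combo ((l , p) ∷ L) i j = l * p i j + combo L i j

totalWeight : ∀ {n} → List (ℚ × Matrix n) → ℚ
totalWeight [] = 0ℚ
totalWeight ((l , _) ∷ L) = l + totalWeight L

Conv : ∀ {n} → (Matrix n → Set) → Matrix n → Set
Conv {n} S x =
  Σ (List (ℚ × Matrix n)) λ L →
    All (λ lp → (0ℚ ≤ proj₁ lp) × S (proj₂ lp)) L ×
    totalWeight L ≡ 1ℚ ×
    (∀ i j → combo L i j ≡ x i j)

BB : ∀ n → Matrix n → Set
BB n = Conv {n} IsSignedPerm

BB₊ : ∀ n → Matrix n → Set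
BB₊ n x = BB n x × NonNeg x

-- Edge subsets of K_{n,n} with edge set [n]×[n], as characteristic functions.
EdgeSet : ℕ → Set
EdgeSet n = Fin n → Fin n → Bool

IsMatching : ∀ {n} → EdgeSet n → Set
IsMatching {n} M = ∀ (i j i′ j′ : Fin n) → M i j ≡ true → M i′ j′ ≡ true →
  (i ≡ i′ ⊎ j ≡ j′) → (i ≡ i′ × j ≡ j′)

indicator : ∀ {n} → EdgeSet n → Matrix n
indicator M i j = if M i j then 1ℚ else 0ℚ

IsMatchingIndicator : ∀ {n} → Matrix n → Set
IsMatchingIndicator {n} x = Σ (EdgeSet n) λ M → IsMatching M × (∀ i j → indicator M i j ≡ x i j)

MatchingPolytope : ∀ n → Matrix n → Set
MatchingPolytope n = Conv {n} IsMatchingIndicator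

{-# OPTIONS --safe #-}
-- A nonnegative convex combination of signed permutation matrices is dominated entrywise by the
-- same combination of their positive parts, which are matching indicators; and the matching
-- polytope is down-closed in the nonnegative orthant, since lowering one coordinate interpolates
-- between a point and that point with the coordinate zeroed, and deleting an edge keeps a matching.
-- Conversely, a matching extends to a permutation σ, and its indicator is the midpoint of the
-- permutation matrix of σ and the signed permutation matrix that agrees with it on the matching
-- and is −1 on the rest of the graph of σ.
module Submission where

open import Defs
open import Data.Nat using (ℕ)
open import Data.Product using (_×_; Σ; _,_; proj₁; proj₂; map₁; map₂)
open import Data.Bool using (Bool; true; false; if_then_else_)
import Data.Bool.Properties as Bool
open import Data.Empty using (⊥-elim)
open import Data.Fin using (Fin)
open import Data.Fin.Permutation using (Permutation′; _⟨$⟩ʳ_; _⟨$⟩ˡ_; inverseˡ; inverseʳ; id; transpose; _∘ₚ_)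
import Data.Fin.Permutation.Components as PC
open import Data.Fin.Properties using (any?) renaming (_≟_ to _≟ᶠ_)
open import Data.List using (List; []; _∷_; _++_; map; allFin; cartesianProduct)
open import Data.List.Membership.Propositional using (_∈_)
open import Data.List.Membership.Propositional.Properties using (∈-allFin; ∈-cartesianProduct⁺)
open import Data.List.Relation.Unary.All as All using (All; []; _∷_)
open import Data.List.Relation.Unary.All.Properties using (++⁺; map⁺)
open import Data.List.Relation.Unary.Any using (tail)
open import Data.Product.Properties using (≡-dec)
open import Data.Rational using (ℚ; 0ℚ; 1ℚ; ½; -_; _+_; _*_; _-_; _÷_; _≤_; 1/_; NonZero; Positive; ≢-nonZero; nonNegative)
import Data.Rational.Properties as ℚ
open import Data.Rational.Solver using (module +-*-Solver)
open import Data.Sum using (_⊎_; inj₁; inj₂)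
open import Function.Base using (_∘_)
open import Function.Bundles using (Injection)
open import Function.Properties.Inverse using (↔⇒↣)
open import Relation.Binary.PropositionalEquality
open import Relation.Nullary using (Dec; yes; no; does)
open import Relation.Nullary.Decidable using (dec-true; dec-false; decidable-stable)

private
  variable
    n : ℕ

*-nonNeg : ∀ {p q} → 0ℚ ≤ p → 0ℚ ≤ q → 0ℚ ≤ p * q
*-nonNeg {p} {q} 0≤p 0≤q =
  ℚ.nonNegative⁻¹ (p * q) {{ℚ.nonNeg*nonNeg⇒nonNeg p {{nonNegative 0≤p}} q {{nonNegative 0≤q}}}}

p≤q⇒0≤q-p : ∀ {p q} → p ≤ q → 0ℚ ≤ q - p
p≤q⇒0≤q-p {p} p≤q = ℚ.≤-trans (ℚ.≤-reflexive (sym (ℚ.+-inverseʳ p))) (ℚ.+-monoˡ-≤ (- p) p≤q)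

open +-*-Solver using (solve; _:+_; _:*_; _:-_; con; _:=_)

interpolate-same : ∀ r a → r * a + (1ℚ - r) * a ≡ a
interpolate-same = solve 2 (λ r a → r :* a :+ (con 1ℚ :- r) :* a := a) refl

complementary-weights : ∀ r → r + ((1ℚ - r) + 0ℚ) ≡ 1ℚ
complementary-weights = solve 1 (λ r → r :+ ((con 1ℚ :- r) :+ con 0ℚ) := con 1ℚ) refl

Summand : (Matrix n → Set) → ℚ × Matrix n → Set
Summand S lp = 0ℚ ≤ proj₁ lp × S (proj₂ lp)

Conv-resp : ∀ {S : Matrix n → Set} {x y} → (∀ i j → x i j ≡ y i j) → Conv S x → Conv S y
Conv-resp x≗y (L , summands , weight , L≗x) = L , summands , weight , λ i j → trans (L≗x i j) (x≗y i j)

scale : ℚ → List (ℚ × Matrix n) → List (ℚ × Matrix n)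
scale r = map (map₁ (r *_))

totalWeight-scale : ∀ r (L : List (ℚ × Matrix n)) → totalWeight (scale r L) ≡ r * totalWeight L
totalWeight-scale r [] = sym (ℚ.*-zeroʳ r)
totalWeight-scale r ((l , _) ∷ L) =
  trans (cong (r * l +_) (totalWeight-scale r L)) (sym (ℚ.*-distribˡ-+ r l (totalWeight L)))

combo-scale : ∀ r (L : List (ℚ × Matrix n)) i j → combo (scale r L) i j ≡ r * combo L i j
combo-scale r [] i j = sym (ℚ.*-zeroʳ r)
combo-scale r ((l , p) ∷ L) i j =
  trans (cong₂ _+_ (ℚ.*-assoc r l (p i j)) (combo-scale r L i j))
        (sym (ℚ.*-distribˡ-+ r (l * p i j) (combo L i j)))

totalWeight-++ : ∀ (A B : List (ℚ × Matrix n)) → totalWeight (A ++ B) ≡ totalWeight A + totalWeight B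
totalWeight-++ [] B = sym (ℚ.+-identityˡ _)
totalWeight-++ ((l , _) ∷ A) B = trans (cong (l +_) (totalWeight-++ A B)) (sym (ℚ.+-assoc l _ _))

combo-++ : ∀ (A B : List (ℚ × Matrix n)) i j → combo (A ++ B) i j ≡ combo A i j + combo B i j
combo-++ [] B i j = sym (ℚ.+-identityˡ _)
combo-++ ((l , p) ∷ A) B i j =
  trans (cong (l * p i j +_) (combo-++ A B i j)) (sym (ℚ.+-assoc (l * p i j) _ _))

All-scale : ∀ {S : Matrix n → Set} {r} → 0ℚ ≤ r → ∀ {L} → All (Summand S) L → All (Summand S) (scale r L)
All-scale 0≤r [] = []
All-scale 0≤r ((0≤l , s) ∷ summands) = (*-nonNeg 0≤r 0≤l , s) ∷ All-scale 0≤r summands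

module _ {S T : Matrix n → Set} (S⊆ConvT : ∀ {p} → S p → Conv T p) where

  flattenSummands : ∀ {L} → All (Summand S) L →
            Σ (List (ℚ × Matrix n)) λ L′ → All (Summand T) L′ × totalWeight L′ ≡ totalWeight L ×
              (∀ i j → combo L′ i j ≡ combo L i j)
  flattenSummands [] = [] , [] , refl , λ _ _ → refl
  flattenSummands {(l , p) ∷ L} ((0≤l , s) ∷ summands) with S⊆ConvT s | flattenSummands summands
  ... | P , P-summands , P-weight , P≗p | L′ , L′-summands , L′-weight , L′≗L =
    scale l P ++ L′ ,
    ++⁺ (All-scale 0≤l P-summands) L′-summands ,
    trans (totalWeight-++ (scale l P) L′)
      (cong₂ _+_ (trans (totalWeight-scale l P) (trans (cong (l *_) P-weight) (ℚ.*-identityʳ l))) L′-weight) ,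
    λ i j → trans (combo-++ (scale l P) L′ i j)
              (cong₂ _+_ (trans (combo-scale l P i j) (cong (l *_) (P≗p i j))) (L′≗L i j))

  Conv-flatten : ∀ {x} → Conv S x → Conv T x
  Conv-flatten (L , summands , weight , L≗x) with flattenSummands summands
  ... | L′ , L′-summands , L′-weight , L′≗L =
    L′ , L′-summands , trans L′-weight weight , λ i j → trans (L′≗L i j) (L≗x i j)

Conv-convex : ∀ {S : Matrix n → Set} {a b} r → 0ℚ ≤ r → r ≤ 1ℚ → Conv S a → Conv S b →
              Conv S (λ i j → r * a i j + (1ℚ - r) * b i j)
Conv-convex {a = a} {b} r 0≤r r≤1 a∈ b∈ =
  Conv-flatten (λ p∈ → p∈)
    ( (r , a) ∷ (1ℚ - r , b) ∷ []
    , (0≤r , a∈) ∷ (p≤q⇒0≤q-p r≤1 , b∈) ∷ []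
    , complementary-weights r
    , λ i j → cong (r * a i j +_) (ℚ.+-identityʳ _))

mapPoints : (Matrix n → Matrix n) → List (ℚ × Matrix n) → List (ℚ × Matrix n)
mapPoints f = map (map₂ f)

totalWeight-mapPoints : ∀ f (L : List (ℚ × Matrix n)) → totalWeight (mapPoints f L) ≡ totalWeight L
totalWeight-mapPoints f [] = refl
totalWeight-mapPoints f ((l , _) ∷ L) = cong (l +_) (totalWeight-mapPoints f L)

Conv-mapPoints : ∀ {S T : Matrix n → Set} {f} → (∀ {p} → S p → T (f p)) →
                 ∀ {L} → All (Summand S) L → totalWeight L ≡ 1ℚ → Conv T (combo (mapPoints f L))
Conv-mapPoints {f = f} S⇒T {L} summands weight =
  mapPoints f L , map⁺ (All.map (map₂ S⇒T) summands) , trans (totalWeight-mapPoints f L) weight ,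
  λ _ _ → refl

combo-mono : ∀ {S : Matrix n → Set} {f} → (∀ {p} → S p → ∀ i j → p i j ≤ f p i j) →
             ∀ {L} → All (Summand S) L → ∀ i j → combo L i j ≤ combo (mapPoints f L) i j
combo-mono p≤fp [] i j = ℚ.≤-refl
combo-mono p≤fp {(l , _) ∷ _} ((0≤l , s) ∷ summands) i j =
  ℚ.+-mono-≤ (ℚ.*-monoˡ-≤-nonNeg l {{nonNegative 0≤l}} (p≤fp s i j)) (combo-mono p≤fp summands i j)

combo-vanish : ∀ {f : Matrix n → Matrix n} {i j} → (∀ p → f p i j ≡ 0ℚ) →
               ∀ L → combo (mapPoints f L) i j ≡ 0ℚ
combo-vanish fp≡0 [] = refl
combo-vanish fp≡0 ((l , p) ∷ L) =
  trans (cong₂ (λ u v → l * u + v) (fp≡0 p) (combo-vanish fp≡0 L))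
        (trans (ℚ.+-identityʳ (l * 0ℚ)) (ℚ.*-zeroʳ l))

combo-agree : ∀ {f : Matrix n → Matrix n} {i j} → (∀ p → f p i j ≡ p i j) →
              ∀ L → combo (mapPoints f L) i j ≡ combo L i j
combo-agree fp≡p [] = refl
combo-agree fp≡p ((l , p) ∷ L) = cong₂ (λ u v → l * u + v) (fp≡p p) (combo-agree fp≡p L)

Conv-nonNeg : ∀ {S : Matrix n → Set} → (∀ {p} → S p → NonNeg p) → ∀ {x} → Conv S x → NonNeg x
Conv-nonNeg {S = S} S⇒nonNeg (L , summands , _ , L≗x) i j = subst (0ℚ ≤_) (L≗x i j) (combo-nonNeg summands)
  where
  combo-nonNeg : ∀ {L} → All (Summand S) L → 0ℚ ≤ combo L i j
  combo-nonNeg [] = ℚ.≤-refl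
  combo-nonNeg ((0≤l , s) ∷ summands) = ℚ.+-mono-≤ (*-nonNeg 0≤l (S⇒nonNeg s i j)) (combo-nonNeg summands)

_≟²_ : (c d : Fin n × Fin n) → Dec (c ≡ d)
_≟²_ = ≡-dec _≟ᶠ_ _≟ᶠ_

setAt : ∀ {A : Set} → Fin n → Fin n → A → (Fin n → Fin n → A) → Fin n → Fin n → A
setAt a b t z i j with (i , j) ≟² (a , b)
... | yes _ = t
... | no _ = z i j

setAt-same : ∀ {A : Set} (a b : Fin n) t (z : Fin n → Fin n → A) → setAt a b t z a b ≡ t
setAt-same a b t z with (a , b) ≟² (a , b)
... | yes _ = refl
... | no ab≢ab = ⊥-elim (ab≢ab refl)

setAt-other : ∀ {A : Set} {a b i j : Fin n} t (z : Fin n → Fin n → A) →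
              (i , j) ≢ (a , b) → setAt a b t z i j ≡ z i j
setAt-other {a = a} {b} {i} {j} t z ij≢ab with (i , j) ≟² (a , b)
... | yes ij≡ab = ⊥-elim (ij≢ab ij≡ab)
... | no _ = refl

overwrite : List (Fin n × Fin n) → Matrix n → Matrix n → Matrix n
overwrite [] x z = z
overwrite ((a , b) ∷ cs) x z = setAt a b (x a b) (overwrite cs x z)

overwrite-≥ : ∀ cs {x z : Matrix n} → (∀ i j → x i j ≤ z i j) → ∀ i j → x i j ≤ overwrite cs x z i j
overwrite-≥ [] x≤z i j = x≤z i j
overwrite-≥ ((a , b) ∷ cs) x≤z i j with (i , j) ≟² (a , b)
... | yes refl = ℚ.≤-refl
... | no _ = overwrite-≥ cs x≤z i j

overwrite-∈ : ∀ {cs} {x z : Matrix n} {i j} → (i , j) ∈ cs → overwrite cs x z i j ≡ x i j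
overwrite-∈ {cs = (a , b) ∷ cs} {i = i} {j} ij∈ with (i , j) ≟² (a , b)
... | yes refl = refl
... | no ij≢ab = overwrite-∈ (tail ij≢ab ij∈)

module _ {S : Matrix n → Set} (S-zeroAt : ∀ {a b p} → S p → S (setAt a b 0ℚ p)) where

  Conv-zeroAt : ∀ a b {z} → Conv S z → Conv S (setAt a b 0ℚ z)
  Conv-zeroAt a b (L , summands , weight , L≗z) =
    Conv-resp combo-zeroAt (Conv-mapPoints S-zeroAt summands weight)
    where
    combo-zeroAt : ∀ i j → combo (mapPoints (setAt a b 0ℚ) L) i j ≡ setAt a b 0ℚ _ i j
    combo-zeroAt i j with (i , j) ≟² (a , b)
    ... | yes refl = combo-vanish (λ p → setAt-same a b 0ℚ p) L
    ... | no ij≢ab = trans (combo-agree (λ p → setAt-other 0ℚ p ij≢ab) L) (L≗z i j)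

  Conv-lowerAt : ∀ a b {t z} → 0ℚ ≤ t → t ≤ z a b → Conv S z → Conv S (setAt a b t z)
  Conv-lowerAt a b {t} {z} 0≤t t≤z z∈ with z a b ℚ.≟ 0ℚ
  ... | yes z≡0 = Conv-resp unchanged z∈
    where
    unchanged : ∀ i j → z i j ≡ setAt a b t z i j
    unchanged i j with (i , j) ≟² (a , b)
    ... | yes refl = trans z≡0 (ℚ.≤-antisym 0≤t (subst (t ≤_) z≡0 t≤z))
    ... | no _ = refl
  ... | no z≢0 = Conv-resp interpolation (Conv-convex r 0≤r r≤1 z∈ (Conv-zeroAt a b z∈))
    where
    instance
      z>0 : Positive (z a b)
      z>0 = ℚ.nonNeg∧nonZero⇒pos (z a b) {{nonNegative (ℚ.≤-trans 0≤t t≤z)}} {{≢-nonZero z≢0}}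
      z≠0 : NonZero (z a b)
      z≠0 = ℚ.pos⇒nonZero (z a b)
    0≤z⁻¹ : 0ℚ ≤ 1/ z a b
    0≤z⁻¹ = ℚ.nonNegative⁻¹ (1/ z a b) {{ℚ.pos⇒nonNeg (1/ z a b) {{ℚ.1/pos⇒pos (z a b)}}}}
    r : ℚ
    r = t ÷ z a b
    0≤r : 0ℚ ≤ r
    0≤r = *-nonNeg 0≤t 0≤z⁻¹
    r≤1 : r ≤ 1ℚ
    r≤1 = ℚ.≤-trans (ℚ.*-monoʳ-≤-nonNeg (1/ z a b) {{nonNegative 0≤z⁻¹}} t≤z)
                    (ℚ.≤-reflexive (ℚ.*-inverseʳ (z a b)))
    r*z≡t : r * z a b ≡ t
    r*z≡t = trans (ℚ.*-assoc t (1/ z a b) (z a b))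
                  (trans (cong (t *_) (ℚ.*-inverseˡ (z a b))) (ℚ.*-identityʳ t))
    interpolation : ∀ i j → r * z i j + (1ℚ - r) * setAt a b 0ℚ z i j ≡ setAt a b t z i j
    interpolation i j with (i , j) ≟² (a , b)
    ... | yes refl = trans (cong (r * z a b +_) (ℚ.*-zeroʳ (1ℚ - r))) (trans (ℚ.+-identityʳ _) r*z≡t)
    ... | no _ = interpolate-same r (z i j)

  Conv-overwrite : ∀ cs {x z} → NonNeg x → (∀ i j → x i j ≤ z i j) → Conv S z → Conv S (overwrite cs x z)
  Conv-overwrite [] x≥0 x≤z z∈ = z∈
  Conv-overwrite ((a , b) ∷ cs) x≥0 x≤z z∈ =
    Conv-lowerAt a b (x≥0 a b) (overwrite-≥ cs x≤z a b) (Conv-overwrite cs x≥0 x≤z z∈)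

  Conv-downClosed : ∀ {x z} → NonNeg x → (∀ i j → x i j ≤ z i j) → Conv S z → Conv S x
  Conv-downClosed x≥0 x≤z z∈ =
    Conv-resp (λ i j → overwrite-∈ (∈-cartesianProduct⁺ (∈-allFin i) (∈-allFin j)))
      (Conv-overwrite (cartesianProduct (allFin _) (allFin _)) x≥0 x≤z z∈)

IsMatching-⊆ : ∀ {M N : EdgeSet n} → IsMatching M → (∀ {i j} → N i j ≡ true → M i j ≡ true) → IsMatching N
IsMatching-⊆ M-matching N⊆M i j i′ j′ e e′ = M-matching i j i′ j′ (N⊆M e) (N⊆M e′)

setAt-false-⊆ : ∀ a b (M : EdgeSet n) {i j} → setAt a b false M i j ≡ true → M i j ≡ true
setAt-false-⊆ a b M {i} {j} e with (i , j) ≟² (a , b)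
... | no _ = e

matchingIndicator-zeroAt : ∀ {a b} {p : Matrix n} → IsMatchingIndicator p → IsMatchingIndicator (setAt a b 0ℚ p)
matchingIndicator-zeroAt {a = a} {b} (M , M-matching , M≗p) =
  setAt a b false M , IsMatching-⊆ M-matching (setAt-false-⊆ a b M) , deleted≗zeroed
  where
  deleted≗zeroed : ∀ i j → indicator (setAt a b false M) i j ≡ setAt a b 0ℚ _ i j
  deleted≗zeroed i j with (i , j) ≟² (a , b)
  ... | yes _ = refl
  ... | no _ = M≗p i j

matchingIndicator-nonNeg : ∀ {p : Matrix n} → IsMatchingIndicator p → NonNeg p
matchingIndicator-nonNeg (M , _ , M≗p) i j = subst (0ℚ ≤_) (M≗p i j) (indicator-nonNeg (M i j))
  where
  indicator-nonNeg : ∀ e → 0ℚ ≤ (if e then 1ℚ else 0ℚ)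
  indicator-nonNeg true = ℚ.nonNegative⁻¹ 1ℚ
  indicator-nonNeg false = ℚ.≤-refl

positiveEdges : Matrix n → EdgeSet n
positiveEdges P i j = does (P i j ℚ.≟ 1ℚ)

positiveEdges-one : ∀ {P : Matrix n} {i j} → positiveEdges P i j ≡ true → P i j ≡ 1ℚ
positiveEdges-one {P = P} {i} {j} e with P i j ℚ.≟ 1ℚ
... | yes P≡1 = P≡1

module _ {P : Matrix n} (P-signed : IsSignedPerm P) where

  signedPerm-entry : ∀ i j → P i j ≡ 1ℚ ⊎ P i j ≡ - 1ℚ ⊎ P i j ≡ 0ℚ
  signedPerm-entry i j with proj₁ P-signed i
  ... | j₀ , ±1 , off with j ≟ᶠ j₀
  ...   | yes refl = Data.Sum.map₂ inj₁ ±1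
  ...   | no j≢j₀ = inj₂ (inj₂ (off j j≢j₀))

  row-support : ∀ {i j} → P i j ≢ 0ℚ → j ≡ proj₁ (proj₁ P-signed i)
  row-support {i} {j} P≢0 = decidable-stable (j ≟ᶠ _) λ j≢ → P≢0 (proj₂ (proj₂ (proj₁ P-signed i)) j j≢)

  column-support : ∀ {i j} → P i j ≢ 0ℚ → i ≡ proj₁ (proj₂ P-signed j)
  column-support {i} {j} P≢0 = decidable-stable (i ≟ᶠ _) λ i≢ → P≢0 (proj₂ (proj₂ (proj₂ P-signed j)) i i≢)

  positiveEdge-nonzero : ∀ {i j} → positiveEdges P i j ≡ true → P i j ≢ 0ℚ
  positiveEdge-nonzero e P≡0 = ℚ.1≢0 (trans (sym (positiveEdges-one {P = P} e)) P≡0)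

  positiveEdges-matching : IsMatching (positiveEdges P)
  positiveEdges-matching i j i′ j′ e e′ (inj₁ refl) =
    refl , trans (row-support (positiveEdge-nonzero e)) (sym (row-support (positiveEdge-nonzero e′)))
  positiveEdges-matching i j i′ j′ e e′ (inj₂ refl) =
    trans (column-support (positiveEdge-nonzero e)) (sym (column-support (positiveEdge-nonzero e′))) , refl

  ≤-positivePart : ∀ i j → P i j ≤ indicator (positiveEdges P) i j
  ≤-positivePart i j with P i j ℚ.≟ 1ℚ | signedPerm-entry i j
  ... | yes P≡1 | _ = ℚ.≤-reflexive P≡1
  ... | no P≢1 | inj₁ P≡1 = ⊥-elim (P≢1 P≡1)
  ... | no _ | inj₂ (inj₁ P≡-1) = ℚ.≤-trans (ℚ.≤-reflexive P≡-1) (ℚ.nonPositive⁻¹ (- 1ℚ))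
  ... | no _ | inj₂ (inj₂ P≡0) = ℚ.≤-reflexive P≡0

  positivePart-matchingIndicator : IsMatchingIndicator (indicator (positiveEdges P))
  positivePart-matchingIndicator = positiveEdges P , positiveEdges-matching , λ _ _ → refl

BB₊⊆MatchingPolytope : ∀ {x : Matrix n} → BB₊ n x → MatchingPolytope n x
BB₊⊆MatchingPolytope {x = x} ((L , summands , weight , L≗x) , x≥0) =
  Conv-downClosed matchingIndicator-zeroAt x≥0 x≤positiveParts
    (Conv-mapPoints positivePart-matchingIndicator summands weight)
  where
  x≤positiveParts : ∀ i j → x i j ≤ combo (mapPoints (indicator ∘ positiveEdges) L) i j
  x≤positiveParts i j = subst (_≤ _) (L≗x i j) (combo-mono ≤-positivePart summands i j)

transpose-matchˡ : ∀ (a b : Fin n) → PC.transpose a b a ≡ b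
transpose-matchˡ a b rewrite dec-true (a ≟ᶠ a) refl = refl

transpose-fixes : ∀ {a b k : Fin n} → k ≢ a → k ≢ b → PC.transpose a b k ≡ k
transpose-fixes {a = a} {b} {k} k≢a k≢b rewrite dec-false (k ≟ᶠ a) k≢a | dec-false (k ≟ᶠ b) k≢b = refl

module _ {M : EdgeSet n} (M-matching : IsMatching M) where

  ExtendsOn : Permutation′ n → List (Fin n) → Set
  ExtendsOn σ rows = ∀ {i j} → i ∈ rows → M i j ≡ true → σ ⟨$⟩ʳ i ≡ j

  extendOn : ∀ rows → Σ (Permutation′ n) λ σ → ExtendsOn σ rows
  extendOn [] = id , λ ()
  extendOn (r ∷ rows) with extendOn rows | any? (λ j → M r j Bool.≟ true)
  ... | σ , σ-extends | no unmatched = σ , σ-extends′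
    where
    σ-extends′ : ExtendsOn σ (r ∷ rows)
    σ-extends′ {i} i∈ e with i ≟ᶠ r
    ... | yes refl = ⊥-elim (unmatched (_ , e))
    ... | no i≢r = σ-extends (tail i≢r i∈) e
  ... | σ , σ-extends | yes (j , e) = σ ∘ₚ transpose (σ ⟨$⟩ʳ r) j , σ′-extends
    where
    σ′-extends : ExtendsOn (σ ∘ₚ transpose (σ ⟨$⟩ʳ r) j) (r ∷ rows)
    σ′-extends {i} {j′} i∈ e′ with i ≟ᶠ r
    ... | yes refl = trans (transpose-matchˡ (σ ⟨$⟩ʳ r) j) (proj₂ (M-matching r j r j′ e e′ (inj₁ refl)))
    ... | no i≢r = trans (transpose-fixes σi≢σr σi≢j) σi≡j′
      where
      σi≡j′ : σ ⟨$⟩ʳ i ≡ j′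
      σi≡j′ = σ-extends (tail i≢r i∈) e′
      σi≢σr : σ ⟨$⟩ʳ i ≢ σ ⟨$⟩ʳ r
      σi≢σr = i≢r ∘ Injection.injective (↔⇒↣ σ)
      σi≢j : σ ⟨$⟩ʳ i ≢ j
      σi≢j σi≡j = i≢r (proj₁ (M-matching i j′ r j e′ e (inj₂ (trans (sym σi≡j′) σi≡j))))

  matching⇒permutation : Σ (Permutation′ n) λ σ → ∀ {i j} → M i j ≡ true → σ ⟨$⟩ʳ i ≡ j
  matching⇒permutation with extendOn (allFin n)
  ... | σ , σ-extends = σ , λ {i} → σ-extends (∈-allFin i)

sign : Bool → ℚ
sign true = 1ℚ
sign false = - 1ℚ

sign-±1 : ∀ b → sign b ≡ 1ℚ ⊎ sign b ≡ - 1ℚ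
sign-±1 true = inj₁ refl
sign-±1 false = inj₂ refl

signedPermMatrix : Permutation′ n → (Fin n → ℚ) → Matrix n
signedPermMatrix σ s i j = if does (σ ⟨$⟩ʳ i ≟ᶠ j) then s i else 0ℚ

signedPermMatrix-isSignedPerm : ∀ (σ : Permutation′ n) s → (∀ i → s i ≡ 1ℚ ⊎ s i ≡ - 1ℚ) →
                              IsSignedPerm (signedPermMatrix σ s)
signedPermMatrix-isSignedPerm σ s ±1 =
  (λ i → σ ⟨$⟩ʳ i , subst (λ v → v ≡ 1ℚ ⊎ v ≡ - 1ℚ) (sym (on-graph refl)) (±1 i) ,
         λ j σi≢j → off-graph (σi≢j ∘ sym)) ,
  (λ j → σ ⟨$⟩ˡ j , subst (λ v → v ≡ 1ℚ ⊎ v ≡ - 1ℚ) (sym (on-graph (inverseʳ σ))) (±1 _) ,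
         λ i i≢σ⁻¹j → off-graph λ σi≡j → i≢σ⁻¹j (trans (sym (inverseˡ σ)) (cong (σ ⟨$⟩ˡ_) σi≡j)))
  where
  on-graph : ∀ {i j} → σ ⟨$⟩ʳ i ≡ j → signedPermMatrix σ s i j ≡ s i
  on-graph {i} {j} σi≡j = cong (λ e → if e then s i else 0ℚ) (dec-true (σ ⟨$⟩ʳ i ≟ᶠ j) σi≡j)
  off-graph : ∀ {i j} → σ ⟨$⟩ʳ i ≢ j → signedPermMatrix σ s i j ≡ 0ℚ
  off-graph {i} {j} σi≢j = cong (λ e → if e then s i else 0ℚ) (dec-false (σ ⟨$⟩ʳ i ≟ᶠ j) σi≢j)

matchingIndicator∈BB : ∀ {p : Matrix n} → IsMatchingIndicator p → BB n p
matchingIndicator∈BB {n} (M , M-matching , M≗p) with matching⇒permutation M-matching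
... | σ , σ⊇M =
  (½ , P⁺) ∷ (½ , P⁻) ∷ [] ,
  (0≤½ , signedPermMatrix-isSignedPerm σ _ (λ _ → inj₁ refl)) ∷
    (0≤½ , signedPermMatrix-isSignedPerm σ _ (λ i → sign-±1 (M i (σ ⟨$⟩ʳ i)))) ∷ [] ,
  refl ,
  λ i j → trans (midpoint i j) (M≗p i j)
  where
  P⁺ P⁻ : Matrix n
  P⁺ = signedPermMatrix σ λ _ → 1ℚ
  P⁻ = signedPermMatrix σ λ i → sign (M i (σ ⟨$⟩ʳ i))
  0≤½ : 0ℚ ≤ ½
  0≤½ = ℚ.nonNegative⁻¹ ½
  midpoint : ∀ i j → ½ * P⁺ i j + (½ * P⁻ i j + 0ℚ) ≡ indicator M i j
  midpoint i j with σ ⟨$⟩ʳ i ≟ᶠ j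
  midpoint i j | yes refl with M i (σ ⟨$⟩ʳ i)
  ... | true = refl
  ... | false = refl
  midpoint i j | no σi≢j with M i j in e
  ... | true = ⊥-elim (σi≢j (σ⊇M e))
  ... | false = refl

corollary5p5 : ∀ (n : ℕ) (x : Matrix n) →
    (BB₊ n x → MatchingPolytope n x) × (MatchingPolytope n x → BB₊ n x)
corollary5p5 n x =
  BB₊⊆MatchingPolytope ,
  λ x∈ → Conv-flatten matchingIndicator∈BB x∈ , Conv-nonNeg matchingIndicator-nonNeg x∈
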